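{- Let $M$ be a Symmetric Perfect Matroid Design (SPMD) of rank $r$, and let $B$ be a basis of $M$. Then the number of hyperplanes $H$ of $M$ which contain no element of $B$ is precisely \[ n=\sum_{k=0}^{r-1}(-1)^k\frac{\binom{r}{k}\,\langle r \mid r-1\rangle\,\langle r-1 \mid k\rangle}{\langle r \mid k\rangle}. \]
   Context: Matroids are finite; a hyperplane is a flat of rank $\rho(E)-1$. A matroid $M$ of rank $r$ is called a Symmetric Perfect Matroid Design (SPMD) if (i) for each $j<r$, all flats of rank $j$ in $M$ are isomorphic (as matroids, under restriction), and (ii) for all $s,u$, the number of flats of rank $s$ in $M$ containing a fixed flat $M'$ of rank $u$ is a number $f(r,s,u)$ that does not depend on the choice of $M'$. For an SPMD, $\langle m \mid k\rangle$ denotes the number of flats of rank $k$ in an SPMD of rank $m$ (here: for $m=r$, the number of rank-$k$ flats of $M$; for $m=r-1$, the number of rank-$k$ flats of any hyperplane of $M$, which is well defined since all hyperplanes are isomorphic). In particular $\langle m\mid 0\rangle=1$. -}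

module Defs where

open import Data.Nat using (ℕ; zero; suc; _≤_; _<_; _<?_)
open import Data.Nat.Combinatorics using (_C_)
open import Data.Bool using (Bool)
open import Data.Fin using (Fin)
open import Data.Fin.Properties using (all?)
open import Data.Fin.Subset using (Subset; _∈_; _∉_; _⊆_; _∪_; _∩_; ⁅_⁆; ∣_∣; ⊤; inside; outside)
open import Data.Fin.Subset.Properties using (_∈?_; _⊆?_)
open import Data.Vec using (Vec; []; _∷_; tabulate; lookup)
open import Data.List using (List; []; _∷_; _++_; map; length; filter)
open import Data.Integer using (+_)
open import Data.Rational using (ℚ; 0ℚ; 1ℚ; -_; _/_; _+_; _*_)
open import Data.Product using (Σ; _×_; _,_)
open import Function.Bundles using (_↔_; Inverse)
open import Relation.Binary.PropositionalEquality using (_≡_)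
open import Relation.Nullary using (¬_; Dec; ¬?; _×-dec_; _→-dec_)
open import Relation.Unary using (Pred; Decidable)

record Matroid (n : ℕ) : Set where
  field
    ρ       : Subset n → ℕ
    R1      : ∀ X → ρ X ≤ ∣ X ∣
    R2      : ∀ X Y → X ⊆ Y → ρ X ≤ ρ Y
    R3      : ∀ X Y → ρ (X ∪ Y) Data.Nat.+ ρ (X ∩ Y) ≤ ρ X Data.Nat.+ ρ Y

module _ {n : ℕ} (M : Matroid n) where
  open Matroid M

  rk : ℕ
  rk = ρ ⊤

  Independent : Subset n → Set
  Independent X = ρ X ≡ ∣ X ∣

  Basis : Subset n → Set
  Basis B = Independent B × (∀ e → e ∉ B → ¬ Independent (B ∪ ⁅ e ⁆))

  Flat : Subset n → Set
  Flat X = ∀ e → e ∉ X → ρ X < ρ (X ∪ ⁅ e ⁆)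

  flat? : Decidable Flat
  flat? X = all? (λ e → ¬? (e ∈? X) →-dec (ρ X <? ρ (X ∪ ⁅ e ⁆)))

  FlatOfRank : ℕ → Subset n → Set
  FlatOfRank k X = Flat X × ρ X ≡ k

  flatOfRank? : ∀ k → Decidable (FlatOfRank k)
  flatOfRank? k X = flat? X ×-dec (ρ X Data.Nat.≟ k)

  Hyperplane : Subset n → Set
  Hyperplane X = Flat X × suc (ρ X) ≡ rk

  -- the restrictions M|F and M|F' are isomorphic matroids: some bijection
  -- of the ground set maps F onto F' and preserves the rank of every
  -- subset of F
  image : (Fin n ↔ Fin n) → Subset n → Subset n
  image π X = tabulate (λ y → lookup X (Inverse.from π y))

  IsoRestr : Subset n → Subset n → Set
  IsoRestr F F' = Σ (Fin n ↔ Fin n) λ π →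
      (∀ x → (x ∈ F → Inverse.to π x ∈ F') × (Inverse.to π x ∈ F' → x ∈ F))
    × (∀ X → X ⊆ F → ρ (image π X) ≡ ρ X)

allSubsets : (n : ℕ) → List (Subset n)
allSubsets zero    = [] ∷ []
allSubsets (suc n) = map (inside ∷_) (allSubsets n) ++ map (outside ∷_) (allSubsets n)

count : ∀ {n} {P : Pred (Subset n) Agda.Primitive.lzero} → Decidable P → ℕ
count {n} P? = length (filter P? (allSubsets n))

module _ {n : ℕ} (M : Matroid n) where
  open Matroid M

  flatsAbove : ℕ → Subset n → ℕ
  flatsAbove s F = count (λ X → flatOfRank? M s X ×-dec (F ⊆? X))

  -- ⟨ r ∣ k ⟩ for M itself: the number of rank-k flats of M
  numFlats : ℕ → ℕ
  numFlats k = count (flatOfRank? M k)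

  -- number of rank-k flats of M|H (for a flat H these are exactly the
  -- rank-k flats of M contained in H)
  numFlatsIn : Subset n → ℕ → ℕ
  numFlatsIn H k = count (λ X → flatOfRank? M k X ×-dec (X ⊆? H))

  numHypAvoiding : Subset n → ℕ
  numHypAvoiding B = count (λ H → (flat? M H ×-dec (suc (ρ H) Data.Nat.≟ rk M))
                                  ×-dec all? (λ e → (e ∈? B) →-dec ¬? (e ∈? H)))

  record SPMD : Set where
    field
      iso   : ∀ j → j < rk M → ∀ F F' → FlatOfRank M j F → FlatOfRank M j F' → IsoRestr M F F'
      const : ∀ s u F F' → FlatOfRank M u F → FlatOfRank M u F' → flatsAbove s F ≡ flatsAbove s F'

-- a / b as a rational; division by zero is set to 0 (never used: the
-- denominators in the theorem are numbers of flats, which are ≥ 1)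
_÷ℕ_ : ℕ → ℕ → ℚ
a ÷ℕ zero    = 0ℚ
a ÷ℕ (suc b) = (+ a) / suc b

ℕ→ℚ : ℕ → ℚ
ℕ→ℚ a = (+ a) / 1

sgn : ℕ → ℚ
sgn zero    = 1ℚ
sgn (suc k) = - sgn k

sumBelow : ℕ → (ℕ → ℚ) → ℚ
sumBelow zero    f = 0ℚ
sumBelow (suc m) f = sumBelow m f + f m

{-# OPTIONS --safe #-}
-- By inclusion–exclusion over the subsets S of the basis B, the number of hyperplanes avoiding B
-- is Σ_{S ⊆ B} (-1)^|S| h(S), where h(S) counts the hyperplanes containing S. A hyperplane
-- contains S iff it contains the rank-|S| flat cl S, so in an SPMD h(S) = f(r, r-1, |S|) depends
-- only on |S| when |S| < r, while no hyperplane contains B. Counting the pairs (rank-k flat,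
-- hyperplane containing it) in two ways, and using that all hyperplanes are isomorphic, gives
-- ⟨r|k⟩ f(r, r-1, k) = ⟨r|r-1⟩ ⟨r-1|k⟩; B has C(r, k) subsets of size k. The alternating sums are
-- kept in ℕ, with their positive and negative parts on opposite sides, until the passage to ℚ.
module Submission where

open import Defs

open import Data.Nat as ℕ using (ℕ; zero; suc; _+_; _*_; _∸_; _≤_; _<_; z≤n; s≤s; _≟_; _⊓_)
open import Data.Nat.Properties
open import Data.Nat.Combinatorics using (_C_; nCk+nC[k+1]≡[n+1]C[k+1])
open import Data.Nat.Coprimality as Coprime using (Coprime; 1-coprimeTo)
open import Data.Nat.ListAction using (sum)
open import Data.Nat.ListAction.Properties using (sum-++)
open import Data.Nat.Solver using (module +-*-Solver)
import Data.Integer as ℤ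
import Data.Integer.Properties as ℤ
open import Data.Rational as ℚ using (ℚ; mkℚ; 0ℚ; 1ℚ)
open import Data.Rational.Properties using (normalize-coprime; /-cong; fromℚᵘ-cong)
open import Data.Rational.Unnormalised using (mkℚᵘ; *≡*)
import Data.Rational.Solver
open import Data.Bool using (Bool; true; false; if_then_else_)
open import Data.Bool.Properties using (T-≡)
open import Data.Fin using (Fin)
import Data.Fin as Fin
open import Data.Fin.Properties using (all?)
open import Data.Fin.Subset using (Subset; inside; outside; _⊆_; _∈_; _∉_; _∪_; _∩_; _─_; ⁅_⁆; ⊤; ∣_∣; Empty)
open import Data.Fin.Subset.Properties
  using ( _⊆?_; _∈?_; nonempty?; drop-∷-Empty; in⊆in; out⊆; drop-∷-⊆; ∣p∣≤n
        ; p⊆p∪q; x∈p∪q⁻; x∈p∪q⁺; x∈p∩q⁺; x∈p∩q⁻; ⊆-antisym; x∈⁅x⁆; x∈⁅y⁆⇒x≡y; ∪-identityʳ; ∪-zeroʳ)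
open import Data.Vec using ([]; _∷_; here; there; tabulate; lookup)
open import Data.Vec.Properties using (≡-dec; ∷-injectiveʳ; lookup∘tabulate; []=⇒lookup; lookup⇒[]=)
open import Data.List using (List; []; _∷_; _++_; map; length; filter; allFin)
open import Data.List.Properties using (map-++; map-∘)
import Data.List.Relation.Unary.Any as LA
import Data.List.Membership.Propositional as LM
open import Data.List.Membership.Propositional.Properties using (∈-allFin)
open import Data.Product using (Σ; _×_; _,_; proj₁; proj₂)
open import Data.Sum using (inj₁; inj₂)
open import Data.Empty using (⊥; ⊥-elim)
open import Function.Bundles using (Equivalence; Inverse; _↔_)
open import Relation.Binary.PropositionalEquality
open import Relation.Nullary using (¬_; Dec; yes; no; does; ¬?; _×-dec_; _→-dec_)
open import Relation.Nullary.Decidable using (isYes; toWitness; fromWitness)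
open import Relation.Unary using (Pred; Decidable)

module ℚS = Data.Rational.Solver.+-*-Solver
open +-*-Solver using (solve; _:+_; _:*_; _:=_)

-- defined through does, so that e.g. 𝟙 (suc a ≟ suc k) and 𝟙 (a ≟ k) are definitionally equal
𝟙 : {P : Set} → Dec P → ℕ
𝟙 d = if does d then 1 else 0

𝟙-yes : {P : Set} (d : Dec P) → P → 𝟙 d ≡ 1
𝟙-yes (yes _) _ = refl
𝟙-yes (no ¬p) p = ⊥-elim (¬p p)

𝟙-no : {P : Set} (d : Dec P) → ¬ P → 𝟙 d ≡ 0
𝟙-no (yes p) ¬p = ⊥-elim (¬p p)
𝟙-no (no _)  _  = refl

𝟙-⇔ : {P Q : Set} (d : Dec P) (e : Dec Q) → (P → Q) → (Q → P) → 𝟙 d ≡ 𝟙 e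
𝟙-⇔ (yes p) e f _ = sym (𝟙-yes e (f p))
𝟙-⇔ (no ¬p) e _ g = sym (𝟙-no e (λ q → ¬p (g q)))

𝟙-× : {P Q : Set} (d : Dec P) (e : Dec Q) → 𝟙 (d ×-dec e) ≡ 𝟙 d * 𝟙 e
𝟙-× (yes _) (yes _) = refl
𝟙-× (yes _) (no _)  = refl
𝟙-× (no _)  _       = refl

𝟙-incompatible : {P Q : Set} (d : Dec P) (e : Dec Q) → (P → Q → ⊥) → 𝟙 d * 𝟙 e ≡ 0
𝟙-incompatible (yes p) (yes q) p⇏q = ⊥-elim (p⇏q p q)
𝟙-incompatible (yes _) (no _)  _   = refl
𝟙-incompatible (no _)  _       _   = refl

even odd : ℕ → ℕ
even zero    = 1
even (suc k) = odd k
odd zero     = 0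
odd (suc k)  = even k

-- Finite sums

∑< : ℕ → (ℕ → ℕ) → ℕ
∑< zero    f = 0
∑< (suc m) f = ∑< m f + f m

∑<-cong : ∀ m {f g : ℕ → ℕ} → (∀ k → k < m → f k ≡ g k) → ∑< m f ≡ ∑< m g
∑<-cong zero    _ = refl
∑<-cong (suc m) e = cong₂ _+_ (∑<-cong m (λ k k<m → e k (m<n⇒m<1+n k<m))) (e m ≤-refl)

∑<-zero : ∀ m {f : ℕ → ℕ} → (∀ k → k < m → f k ≡ 0) → ∑< m f ≡ 0
∑<-zero m e = trans (∑<-cong m e) (zeros m)
  where
  zeros : ∀ m → ∑< m (λ _ → 0) ≡ 0
  zeros zero    = refl
  zeros (suc m) = trans (+-identityʳ _) (zeros m)

∑<-δ : ∀ m j c → j < m → ∑< m (λ k → 𝟙 (j ≟ k) * c) ≡ c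
∑<-δ (suc m) j c j<1+m with j ≟ m
... | yes refl = begin
  ∑< m (λ k → 𝟙 (j ≟ k) * c) + 𝟙 (j ≟ j) * c ≡⟨ cong₂ _+_ (∑<-zero m off-diagonal) (cong (_* c) (𝟙-yes (j ≟ j) refl)) ⟩
  0 + 1 * c                                  ≡⟨ *-identityˡ c ⟩
  c                                          ∎
  where
  open ≡-Reasoning
  off-diagonal : ∀ k → k < m → 𝟙 (j ≟ k) * c ≡ 0
  off-diagonal k k<m = cong (_* c) (𝟙-no (j ≟ k) (λ j≡k → <-irrefl (sym j≡k) k<m))
... | no j≢m = begin
  ∑< m (λ k → 𝟙 (j ≟ k) * c) + 𝟙 (j ≟ m) * c ≡⟨ cong (∑< m (λ k → 𝟙 (j ≟ k) * c) +_) (cong (_* c) (𝟙-no (j ≟ m) j≢m)) ⟩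
  ∑< m (λ k → 𝟙 (j ≟ k) * c) + 0            ≡⟨ +-identityʳ _ ⟩
  ∑< m (λ k → 𝟙 (j ≟ k) * c)                ≡⟨ ∑<-δ m j c (≤∧≢⇒< (≤-pred j<1+m) j≢m) ⟩
  c                                          ∎
  where open ≡-Reasoning

∑<-truncate : ∀ m d (f : ℕ → ℕ) → (∀ k → m ≤ k → f k ≡ 0) → ∑< (d + m) f ≡ ∑< m f
∑<-truncate m zero    f _ = refl
∑<-truncate m (suc d) f z = begin
  ∑< (d + m) f + f (d + m) ≡⟨ cong (∑< (d + m) f +_) (z (d + m) (m≤n+m m d)) ⟩
  ∑< (d + m) f + 0         ≡⟨ +-identityʳ _ ⟩
  ∑< (d + m) f             ≡⟨ ∑<-truncate m d f z ⟩
  ∑< m f                   ∎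
  where open ≡-Reasoning

∑ : ∀ n → (Subset n → ℕ) → ℕ
∑ zero    φ = φ []
∑ (suc n) φ = ∑ n (λ S → φ (inside ∷ S)) + ∑ n (λ S → φ (outside ∷ S))

∑-cong : ∀ n {φ ψ : Subset n → ℕ} → (∀ S → φ S ≡ ψ S) → ∑ n φ ≡ ∑ n ψ
∑-cong zero    e = e []
∑-cong (suc n) e = cong₂ _+_ (∑-cong n (λ S → e (inside ∷ S))) (∑-cong n (λ S → e (outside ∷ S)))

∑-zero : ∀ n {φ : Subset n → ℕ} → (∀ S → φ S ≡ 0) → ∑ n φ ≡ 0
∑-zero zero    e = e []
∑-zero (suc n) e = cong₂ _+_ (∑-zero n (λ S → e (inside ∷ S))) (∑-zero n (λ S → e (outside ∷ S)))

∑-+ : ∀ n (φ ψ : Subset n → ℕ) → ∑ n (λ S → φ S + ψ S) ≡ ∑ n φ + ∑ n ψ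
∑-+ zero    φ ψ = refl
∑-+ (suc n) φ ψ = begin
  ∑ n (λ S → φ (inside ∷ S) + ψ (inside ∷ S)) + ∑ n (λ S → φ (outside ∷ S) + ψ (outside ∷ S))
    ≡⟨ cong₂ _+_ (∑-+ n _ _) (∑-+ n _ _) ⟩
  (a + b) + (c + d)
    ≡⟨ solve 4 (λ a b c d → (a :+ b) :+ (c :+ d) := (a :+ c) :+ (b :+ d)) refl a b c d ⟩
  (a + c) + (b + d) ∎
  where
  open ≡-Reasoning
  a = ∑ n (λ S → φ (inside ∷ S))
  b = ∑ n (λ S → ψ (inside ∷ S))
  c = ∑ n (λ S → φ (outside ∷ S))
  d = ∑ n (λ S → ψ (outside ∷ S))

∑-*ˡ : ∀ n c (φ : Subset n → ℕ) → ∑ n (λ S → c * φ S) ≡ c * ∑ n φ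
∑-*ˡ zero    c φ = refl
∑-*ˡ (suc n) c φ = trans (cong₂ _+_ (∑-*ˡ n c _) (∑-*ˡ n c _)) (sym (*-distribˡ-+ c _ _))

∑-comm : ∀ n m (ψ : Subset n → Subset m → ℕ) →
         ∑ n (λ S → ∑ m (ψ S)) ≡ ∑ m (λ T → ∑ n (λ S → ψ S T))
∑-comm zero    m ψ = refl
∑-comm (suc n) m ψ = trans (cong₂ _+_ (∑-comm n m _) (∑-comm n m _)) (sym (∑-+ m _ _))

∑-∑<-comm : ∀ n m (ψ : Subset n → ℕ → ℕ) →
            ∑ n (λ S → ∑< m (ψ S)) ≡ ∑< m (λ k → ∑ n (λ S → ψ S k))
∑-∑<-comm n zero    ψ = ∑-zero n (λ _ → refl)
∑-∑<-comm n (suc m) ψ = trans (∑-+ n _ _) (cong (_+ ∑ n (λ S → ψ S m)) (∑-∑<-comm n m ψ))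

term≤∑ : ∀ n (φ : Subset n → ℕ) S → φ S ≤ ∑ n φ
term≤∑ zero    φ []            = ≤-refl
term≤∑ (suc n) φ (inside ∷ S)  = ≤-trans (term≤∑ n _ S) (m≤m+n _ _)
term≤∑ (suc n) φ (outside ∷ S) = ≤-trans (term≤∑ n _ S) (m≤n+m _ _)

∑-const-on : ∀ n {P : Pred (Subset n) _} (P? : Decidable P) (φ : Subset n → ℕ) c →
             (∀ S → P S → φ S ≡ c) → ∑ n (λ S → 𝟙 (P? S) * φ S) ≡ ∑ n (λ S → 𝟙 (P? S)) * c
∑-const-on n P? φ c h = begin
  ∑ n (λ S → 𝟙 (P? S) * φ S) ≡⟨ ∑-cong n pointwise ⟩
  ∑ n (λ S → c * 𝟙 (P? S))   ≡⟨ ∑-*ˡ n c _ ⟩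
  c * ∑ n (λ S → 𝟙 (P? S))   ≡⟨ *-comm c _ ⟩
  ∑ n (λ S → 𝟙 (P? S)) * c   ∎
  where
  open ≡-Reasoning
  pointwise : ∀ S → 𝟙 (P? S) * φ S ≡ c * 𝟙 (P? S)
  pointwise S with P? S
  ... | yes p = trans (+-identityʳ (φ S)) (trans (h S p) (sym (*-identityʳ c)))
  ... | no _  = sym (*-zeroʳ c)

∑-by-size : ∀ n (φ : Subset n → ℕ) →
            ∑ n φ ≡ ∑< (suc n) (λ k → ∑ n (λ S → 𝟙 (∣ S ∣ ≟ k) * φ S))
∑-by-size n φ = begin
  ∑ n φ                                          ≡⟨ ∑-cong n (λ S → sym (∑<-δ (suc n) ∣ S ∣ (φ S) (s≤s (∣p∣≤n S)))) ⟩
  ∑ n (λ S → ∑< (suc n) (λ k → 𝟙 (∣ S ∣ ≟ k) * φ S)) ≡⟨ ∑-∑<-comm n (suc n) _ ⟩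
  ∑< (suc n) (λ k → ∑ n (λ S → 𝟙 (∣ S ∣ ≟ k) * φ S)) ∎
  where open ≡-Reasoning

∑-double-count : ∀ n {P Q : Pred (Subset n) _} {R : Subset n → Subset n → Set}
                 (P? : Decidable P) (Q? : Decidable Q) (R? : ∀ F X → Dec (R F X)) →
                 ∑ n (λ F → 𝟙 (P? F) * ∑ n (λ X → 𝟙 (Q? X ×-dec R? F X)))
                 ≡ ∑ n (λ X → 𝟙 (Q? X) * ∑ n (λ F → 𝟙 (P? F ×-dec R? F X)))
∑-double-count n P? Q? R? = begin
  ∑ n (λ F → 𝟙 (P? F) * ∑ n (λ X → 𝟙 (Q? X ×-dec R? F X)))
    ≡⟨ ∑-cong n (λ F → sym (∑-*ˡ n (𝟙 (P? F)) _)) ⟩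
  ∑ n (λ F → ∑ n (λ X → 𝟙 (P? F) * 𝟙 (Q? X ×-dec R? F X)))
    ≡⟨ ∑-comm n n _ ⟩
  ∑ n (λ X → ∑ n (λ F → 𝟙 (P? F) * 𝟙 (Q? X ×-dec R? F X)))
    ≡⟨ ∑-cong n (λ X → ∑-cong n (λ F → swap F X)) ⟩
  ∑ n (λ X → ∑ n (λ F → 𝟙 (Q? X) * 𝟙 (P? F ×-dec R? F X)))
    ≡⟨ ∑-cong n (λ X → ∑-*ˡ n (𝟙 (Q? X)) _) ⟩
  ∑ n (λ X → 𝟙 (Q? X) * ∑ n (λ F → 𝟙 (P? F ×-dec R? F X))) ∎
  where
  open ≡-Reasoning
  swap : ∀ F X → 𝟙 (P? F) * 𝟙 (Q? X ×-dec R? F X) ≡ 𝟙 (Q? X) * 𝟙 (P? F ×-dec R? F X)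
  swap F X rewrite 𝟙-× (Q? X) (R? F X) | 𝟙-× (P? F) (R? F X) =
    solve 3 (λ p q r → p :* (q :* r) := q :* (p :* r)) refl (𝟙 (P? F)) (𝟙 (Q? X)) (𝟙 (R? F X))

count≡∑ : ∀ {n} {P : Pred (Subset n) _} (P? : Decidable P) → count P? ≡ ∑ n (λ S → 𝟙 (P? S))
count≡∑ {n} P? = trans (length-filter (allSubsets n)) (sum-allSubsets n _)
  where
  length-filter : ∀ xs → length (filter P? xs) ≡ sum (map (λ S → 𝟙 (P? S)) xs)
  length-filter []       = refl
  length-filter (S ∷ xs) with does (P? S)
  ... | true  = cong suc (length-filter xs)
  ... | false = length-filter xs

  sum-allSubsets : ∀ m (φ : Subset m → ℕ) → sum (map φ (allSubsets m)) ≡ ∑ m φ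
  sum-allSubsets zero    φ = +-identityʳ (φ [])
  sum-allSubsets (suc m) φ = begin
    sum (map φ (map (inside ∷_) A ++ map (outside ∷_) A))
      ≡⟨ cong sum (map-++ φ (map (inside ∷_) A) _) ⟩
    sum (map φ (map (inside ∷_) A) ++ map φ (map (outside ∷_) A))
      ≡⟨ sum-++ (map φ (map (inside ∷_) A)) _ ⟩
    sum (map φ (map (inside ∷_) A)) + sum (map φ (map (outside ∷_) A))
      ≡⟨ cong₂ (λ x y → sum x + sum y) (sym (map-∘ A)) (sym (map-∘ A)) ⟩
    sum (map (λ S → φ (inside ∷ S)) A) + sum (map (λ S → φ (outside ∷ S)) A)
      ≡⟨ cong₂ _+_ (sum-allSubsets m _) (sum-allSubsets m _) ⟩
    ∑ (suc m) φ ∎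
    where
    open ≡-Reasoning
    A = allSubsets m

infix 4 _≟ₛ_
_≟ₛ_ : ∀ {n} (S T : Subset n) → Dec (S ≡ T)
_≟ₛ_ = ≡-dec Data.Bool._≟_

∑-δ : ∀ n (T : Subset n) (φ : Subset n → ℕ) → ∑ n (λ S → 𝟙 (S ≟ₛ T) * φ S) ≡ φ T
∑-δ zero    []            φ = +-identityʳ (φ [])
∑-δ (suc n) (inside ∷ T)  φ = begin
  ∑ n (λ S → 𝟙 (inside ∷ S ≟ₛ inside ∷ T) * φ (inside ∷ S))
    + ∑ n (λ S → 𝟙 (outside ∷ S ≟ₛ inside ∷ T) * φ (outside ∷ S))
    ≡⟨ cong₂ _+_ (∑-cong n (λ S → cong (_* φ (inside ∷ S)) (𝟙-⇔ (inside ∷ S ≟ₛ inside ∷ T) (S ≟ₛ T) ∷-injectiveʳ (cong (inside ∷_)))))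
                 (∑-zero n (λ S → cong (_* φ (outside ∷ S)) (𝟙-no (outside ∷ S ≟ₛ inside ∷ T) (λ ())))) ⟩
  ∑ n (λ S → 𝟙 (S ≟ₛ T) * φ (inside ∷ S)) + 0
    ≡⟨ trans (+-identityʳ _) (∑-δ n T _) ⟩
  φ (inside ∷ T) ∎
  where open ≡-Reasoning
∑-δ (suc n) (outside ∷ T) φ = begin
  ∑ n (λ S → 𝟙 (inside ∷ S ≟ₛ outside ∷ T) * φ (inside ∷ S))
    + ∑ n (λ S → 𝟙 (outside ∷ S ≟ₛ outside ∷ T) * φ (outside ∷ S))
    ≡⟨ cong₂ _+_ (∑-zero n (λ S → cong (_* φ (inside ∷ S)) (𝟙-no (inside ∷ S ≟ₛ outside ∷ T) (λ ()))))
                 (∑-cong n (λ S → cong (_* φ (outside ∷ S)) (𝟙-⇔ (outside ∷ S ≟ₛ outside ∷ T) (S ≟ₛ T) ∷-injectiveʳ (cong (outside ∷_))))) ⟩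
  0 + ∑ n (λ S → 𝟙 (S ≟ₛ T) * φ (outside ∷ S))
    ≡⟨ ∑-δ n T _ ⟩
  φ (outside ∷ T) ∎
  where open ≡-Reasoning

∑-reindex : ∀ n (f g : Subset n → Subset n) → (∀ S → f (g S) ≡ S) → (∀ S → g (f S) ≡ S) →
            (φ : Subset n → ℕ) → ∑ n (λ S → φ (f S)) ≡ ∑ n φ
∑-reindex n f g fg gf φ = begin
  ∑ n (λ S → φ (f S))                                ≡⟨ ∑-cong n (λ S → sym (∑-δ n (f S) φ)) ⟩
  ∑ n (λ S → ∑ n (λ T → 𝟙 (T ≟ₛ f S) * φ T))         ≡⟨ ∑-comm n n _ ⟩
  ∑ n (λ T → ∑ n (λ S → 𝟙 (T ≟ₛ f S) * φ T))         ≡⟨ ∑-cong n (λ T → ∑-cong n (λ S → cong (_* φ T) (T≡fS⇔S≡gT T S))) ⟩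
  ∑ n (λ T → ∑ n (λ S → 𝟙 (S ≟ₛ g T) * φ T))         ≡⟨ ∑-cong n (λ T → ∑-δ n (g T) (λ _ → φ T)) ⟩
  ∑ n φ                                              ∎
  where
  open ≡-Reasoning
  T≡fS⇔S≡gT : ∀ T S → 𝟙 (T ≟ₛ f S) ≡ 𝟙 (S ≟ₛ g T)
  T≡fS⇔S≡gT T S = 𝟙-⇔ (T ≟ₛ f S) (S ≟ₛ g T)
    (λ e → trans (sym (gf S)) (cong g (sym e))) (λ e → trans (sym (fg T)) (cong f (sym e)))

-- Binomial counts and inclusion–exclusion

∑⊆-inside : ∀ n (T : Subset n) (φ : Subset (suc n) → ℕ) →
            ∑ (suc n) (λ S → 𝟙 (S ⊆? inside ∷ T) * φ S)
            ≡ ∑ n (λ S → 𝟙 (S ⊆? T) * φ (inside ∷ S)) + ∑ n (λ S → 𝟙 (S ⊆? T) * φ (outside ∷ S))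
∑⊆-inside n T φ = cong₂ _+_
  (∑-cong n (λ S → cong (_* φ (inside ∷ S)) (𝟙-⇔ (inside ∷ S ⊆? inside ∷ T) (S ⊆? T) drop-∷-⊆ in⊆in)))
  (∑-cong n (λ S → cong (_* φ (outside ∷ S)) (𝟙-⇔ (outside ∷ S ⊆? inside ∷ T) (S ⊆? T) drop-∷-⊆ out⊆)))

∑⊆-outside : ∀ n (T : Subset n) (φ : Subset (suc n) → ℕ) →
             ∑ (suc n) (λ S → 𝟙 (S ⊆? outside ∷ T) * φ S) ≡ ∑ n (λ S → 𝟙 (S ⊆? T) * φ (outside ∷ S))
∑⊆-outside n T φ = cong₂ _+_
  (∑-zero n (λ S → cong (_* φ (inside ∷ S)) (𝟙-no (inside ∷ S ⊆? outside ∷ T) (λ S⊆T → zero∉ (S⊆T here)))))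
  (∑-cong n (λ S → cong (_* φ (outside ∷ S)) (𝟙-⇔ (outside ∷ S ⊆? outside ∷ T) (S ⊆? T) drop-∷-⊆ out⊆)))
  where
  zero∉ : Fin.zero ∉ outside ∷ T
  zero∉ ()

number-of-subsets-of-size : ∀ n (T : Subset n) k → ∑ n (λ S → 𝟙 (S ⊆? T) * 𝟙 (∣ S ∣ ≟ k)) ≡ ∣ T ∣ C k
number-of-subsets-of-size zero    []           zero    = refl
number-of-subsets-of-size zero    []           (suc k) = refl
number-of-subsets-of-size (suc n) (inside ∷ T) zero    = begin
  ∑ (suc n) (λ S → 𝟙 (S ⊆? inside ∷ T) * 𝟙 (∣ S ∣ ≟ 0))
    ≡⟨ ∑⊆-inside n T (λ S → 𝟙 (∣ S ∣ ≟ 0)) ⟩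
  ∑ n (λ S → 𝟙 (S ⊆? T) * 0) + ∑ n (λ S → 𝟙 (S ⊆? T) * 𝟙 (∣ S ∣ ≟ 0))
    ≡⟨ cong₂ _+_ (∑-zero n (λ S → *-zeroʳ (𝟙 (S ⊆? T)))) (number-of-subsets-of-size n T 0) ⟩
  1 ∎
  where open ≡-Reasoning
number-of-subsets-of-size (suc n) (inside ∷ T) (suc k) = begin
  ∑ (suc n) (λ S → 𝟙 (S ⊆? inside ∷ T) * 𝟙 (∣ S ∣ ≟ suc k))
    ≡⟨ ∑⊆-inside n T (λ S → 𝟙 (∣ S ∣ ≟ suc k)) ⟩
  ∑ n (λ S → 𝟙 (S ⊆? T) * 𝟙 (∣ S ∣ ≟ k)) + ∑ n (λ S → 𝟙 (S ⊆? T) * 𝟙 (∣ S ∣ ≟ suc k))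
    ≡⟨ cong₂ _+_ (number-of-subsets-of-size n T k) (number-of-subsets-of-size n T (suc k)) ⟩
  ∣ T ∣ C k + ∣ T ∣ C suc k
    ≡⟨ nCk+nC[k+1]≡[n+1]C[k+1] ∣ T ∣ k ⟩
  suc ∣ T ∣ C suc k ∎
  where open ≡-Reasoning
number-of-subsets-of-size (suc n) (outside ∷ T) k =
  trans (∑⊆-outside n T (λ S → 𝟙 (∣ S ∣ ≟ k))) (number-of-subsets-of-size n T k)

subset-of-size : ∀ {n} (T : Subset n) k → k ≤ ∣ T ∣ → Σ (Subset n) λ S → S ⊆ T × ∣ S ∣ ≡ k
subset-of-size []            zero    _         = [] , (λ x → x) , refl
subset-of-size (inside ∷ T)  zero    _         with subset-of-size T zero z≤n
... | S , S⊆T , ∣S∣≡k = outside ∷ S , out⊆ S⊆T , ∣S∣≡k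
subset-of-size (inside ∷ T)  (suc k) (s≤s k≤∣T∣) with subset-of-size T k k≤∣T∣
... | S , S⊆T , ∣S∣≡k = inside ∷ S , in⊆in S⊆T , cong suc ∣S∣≡k
subset-of-size (outside ∷ T) k       k≤∣T∣     with subset-of-size T k k≤∣T∣
... | S , S⊆T , ∣S∣≡k = outside ∷ S , out⊆ S⊆T , ∣S∣≡k

empty? : ∀ {n} → Decidable (Empty {n})
empty? T = ¬? (nonempty? T)

inclusion–exclusion : ∀ n (T : Subset n) →
  𝟙 (empty? T) + ∑ n (λ S → 𝟙 (S ⊆? T) * odd ∣ S ∣) ≡ ∑ n (λ S → 𝟙 (S ⊆? T) * even ∣ S ∣)
inclusion–exclusion zero    []           = refl
inclusion–exclusion (suc n) (inside ∷ T) = begin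
  𝟙 (empty? (inside ∷ T)) + ∑ (suc n) (λ S → 𝟙 (S ⊆? inside ∷ T) * odd ∣ S ∣)
    ≡⟨ cong₂ _+_ (𝟙-no (empty? (inside ∷ T)) (λ ¬ne → ¬ne (Fin.zero , here))) (∑⊆-inside n T (λ S → odd ∣ S ∣)) ⟩
  0 + (∑ n (λ S → 𝟙 (S ⊆? T) * even ∣ S ∣) + ∑ n (λ S → 𝟙 (S ⊆? T) * odd ∣ S ∣))
    ≡⟨ +-comm (∑ n (λ S → 𝟙 (S ⊆? T) * even ∣ S ∣)) _ ⟩
  ∑ n (λ S → 𝟙 (S ⊆? T) * odd ∣ S ∣) + ∑ n (λ S → 𝟙 (S ⊆? T) * even ∣ S ∣)
    ≡⟨ ∑⊆-inside n T (λ S → even ∣ S ∣) ⟨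
  ∑ (suc n) (λ S → 𝟙 (S ⊆? inside ∷ T) * even ∣ S ∣) ∎
  where open ≡-Reasoning
inclusion–exclusion (suc n) (outside ∷ T) = begin
  𝟙 (empty? (outside ∷ T)) + ∑ (suc n) (λ S → 𝟙 (S ⊆? outside ∷ T) * odd ∣ S ∣)
    ≡⟨ cong₂ _+_ (𝟙-⇔ (empty? (outside ∷ T)) (empty? T) drop-∷-Empty empty-∷) (∑⊆-outside n T (λ S → odd ∣ S ∣)) ⟩
  𝟙 (empty? T) + ∑ n (λ S → 𝟙 (S ⊆? T) * odd ∣ S ∣)
    ≡⟨ inclusion–exclusion n T ⟩
  ∑ n (λ S → 𝟙 (S ⊆? T) * even ∣ S ∣)
    ≡⟨ ∑⊆-outside n T (λ S → even ∣ S ∣) ⟨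
  ∑ (suc n) (λ S → 𝟙 (S ⊆? outside ∷ T) * even ∣ S ∣) ∎
  where
  open ≡-Reasoning
  empty-∷ : Empty T → Empty (outside ∷ T)
  empty-∷ ¬ne (Fin.suc x , there x∈T) = ¬ne (x , x∈T)

∑⊆-by-size : ∀ n (B : Subset n) (φ : Subset n → ℕ) (ψ : ℕ → ℕ) → (∀ S → S ⊆ B → φ S ≡ ψ ∣ S ∣) →
             ∑ n (λ S → 𝟙 (S ⊆? B) * φ S) ≡ ∑< (suc n) (λ k → (∣ B ∣ C k) * ψ k)
∑⊆-by-size n B φ ψ φ≡ψ = trans (∑-by-size n _) (∑<-cong (suc n) (λ k _ → size k))
  where
  open ≡-Reasoning
  size : ∀ k → ∑ n (λ S → 𝟙 (∣ S ∣ ≟ k) * (𝟙 (S ⊆? B) * φ S)) ≡ (∣ B ∣ C k) * ψ k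
  size k = begin
    ∑ n (λ S → 𝟙 (∣ S ∣ ≟ k) * (𝟙 (S ⊆? B) * φ S))
      ≡⟨ ∑-cong n (λ S → trans (solve 3 (λ a b c → a :* (b :* c) := (b :* a) :* c) refl (𝟙 (∣ S ∣ ≟ k)) (𝟙 (S ⊆? B)) (φ S))
                               (cong (_* φ S) (sym (𝟙-× (S ⊆? B) (∣ S ∣ ≟ k))))) ⟩
    ∑ n (λ S → 𝟙 ((S ⊆? B) ×-dec (∣ S ∣ ≟ k)) * φ S)
      ≡⟨ ∑-const-on n (λ S → (S ⊆? B) ×-dec (∣ S ∣ ≟ k)) φ (ψ k)
           (λ S (S⊆B , ∣S∣≡k) → trans (φ≡ψ S S⊆B) (cong ψ ∣S∣≡k)) ⟩
    ∑ n (λ S → 𝟙 ((S ⊆? B) ×-dec (∣ S ∣ ≟ k))) * ψ k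
      ≡⟨ cong (_* ψ k) (trans (∑-cong n (λ S → 𝟙-× (S ⊆? B) (∣ S ∣ ≟ k))) (number-of-subsets-of-size n B k)) ⟩
    (∣ B ∣ C k) * ψ k ∎

numAbove : ∀ {n} {P : Pred (Subset n) _} → Decidable P → Subset n → ℕ
numAbove {n} P? S = ∑ n (λ H → 𝟙 (P? H) * 𝟙 (S ⊆? H))

∑-⊆-∩ : ∀ n {P : Pred (Subset n) _} (P? : Decidable P) (B : Subset n) (w : ℕ → ℕ) →
        ∑ n (λ H → 𝟙 (P? H) * ∑ n (λ S → 𝟙 (S ⊆? B ∩ H) * w ∣ S ∣))
        ≡ ∑ n (λ S → 𝟙 (S ⊆? B) * (w ∣ S ∣ * numAbove P? S))
∑-⊆-∩ n P? B w = begin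
  ∑ n (λ H → 𝟙 (P? H) * ∑ n (λ S → 𝟙 (S ⊆? B ∩ H) * w ∣ S ∣))
    ≡⟨ ∑-cong n (λ H → sym (∑-*ˡ n (𝟙 (P? H)) _)) ⟩
  ∑ n (λ H → ∑ n (λ S → 𝟙 (P? H) * (𝟙 (S ⊆? B ∩ H) * w ∣ S ∣)))
    ≡⟨ ∑-comm n n _ ⟩
  ∑ n (λ S → ∑ n (λ H → 𝟙 (P? H) * (𝟙 (S ⊆? B ∩ H) * w ∣ S ∣)))
    ≡⟨ ∑-cong n (λ S → ∑-cong n (λ H → rearrange S H)) ⟩
  ∑ n (λ S → ∑ n (λ H → (𝟙 (S ⊆? B) * w ∣ S ∣) * (𝟙 (P? H) * 𝟙 (S ⊆? H))))
    ≡⟨ ∑-cong n (λ S → trans (∑-*ˡ n (𝟙 (S ⊆? B) * w ∣ S ∣) _) (*-assoc (𝟙 (S ⊆? B)) _ _)) ⟩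
  ∑ n (λ S → 𝟙 (S ⊆? B) * (w ∣ S ∣ * numAbove P? S)) ∎
  where
  open ≡-Reasoning
  ⊆∩ : ∀ S H → 𝟙 (S ⊆? B ∩ H) ≡ 𝟙 (S ⊆? B) * 𝟙 (S ⊆? H)
  ⊆∩ S H = trans (𝟙-⇔ (S ⊆? B ∩ H) ((S ⊆? B) ×-dec (S ⊆? H))
                   (λ S⊆ → (λ x∈ → proj₁ (x∈p∩q⁻ B H (S⊆ x∈))) , (λ x∈ → proj₂ (x∈p∩q⁻ B H (S⊆ x∈))))
                   (λ (S⊆B , S⊆H) x∈ → x∈p∩q⁺ (S⊆B x∈ , S⊆H x∈)))
                 (𝟙-× (S ⊆? B) (S ⊆? H))
  rearrange : ∀ S H → 𝟙 (P? H) * (𝟙 (S ⊆? B ∩ H) * w ∣ S ∣) ≡ (𝟙 (S ⊆? B) * w ∣ S ∣) * (𝟙 (P? H) * 𝟙 (S ⊆? H))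
  rearrange S H = trans (cong (λ z → 𝟙 (P? H) * (z * w ∣ S ∣)) (⊆∩ S H))
    (solve 4 (λ p b h v → p :* ((b :* h) :* v) := (b :* v) :* (p :* h)) refl (𝟙 (P? H)) (𝟙 (S ⊆? B)) (𝟙 (S ⊆? H)) (w ∣ S ∣))

inclusion–exclusion-disjoint : ∀ n {P : Pred (Subset n) _} (P? : Decidable P) (B : Subset n) →
  ∑ n (λ H → 𝟙 (P? H) * 𝟙 (empty? (B ∩ H))) + ∑ n (λ S → 𝟙 (S ⊆? B) * (odd ∣ S ∣ * numAbove P? S))
  ≡ ∑ n (λ S → 𝟙 (S ⊆? B) * (even ∣ S ∣ * numAbove P? S))
inclusion–exclusion-disjoint n P? B = begin
  ∑ n (λ H → 𝟙 (P? H) * 𝟙 (empty? (B ∩ H))) + ∑ n (λ S → 𝟙 (S ⊆? B) * (odd ∣ S ∣ * numAbove P? S))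
    ≡⟨ cong (∑ n (λ H → 𝟙 (P? H) * 𝟙 (empty? (B ∩ H))) +_) (∑-⊆-∩ n P? B odd) ⟨
  ∑ n (λ H → 𝟙 (P? H) * 𝟙 (empty? (B ∩ H))) + ∑ n (λ H → 𝟙 (P? H) * ∑ n (λ S → 𝟙 (S ⊆? B ∩ H) * odd ∣ S ∣))
    ≡⟨ ∑-+ n _ _ ⟨
  ∑ n (λ H → 𝟙 (P? H) * 𝟙 (empty? (B ∩ H)) + 𝟙 (P? H) * ∑ n (λ S → 𝟙 (S ⊆? B ∩ H) * odd ∣ S ∣))
    ≡⟨ ∑-cong n (λ H → trans (sym (*-distribˡ-+ (𝟙 (P? H)) _ _)) (cong (𝟙 (P? H) *_) (inclusion–exclusion n (B ∩ H)))) ⟩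
  ∑ n (λ H → 𝟙 (P? H) * ∑ n (λ S → 𝟙 (S ⊆? B ∩ H) * even ∣ S ∣))
    ≡⟨ ∑-⊆-∩ n P? B even ⟩
  ∑ n (λ S → 𝟙 (S ⊆? B) * (even ∣ S ∣ * numAbove P? S)) ∎
  where open ≡-Reasoning

p∪⁅x⁆⊆q : ∀ {n} {p q : Subset n} {x} → p ⊆ q → x ∈ q → p ∪ ⁅ x ⁆ ⊆ q
p∪⁅x⁆⊆q {p = p} {q} {x} p⊆q x∈q y∈ with x∈p∪q⁻ p ⁅ x ⁆ y∈
... | inj₁ y∈p   = p⊆q y∈p
... | inj₂ y∈⁅x⁆ = subst (_∈ q) (sym (x∈⁅y⁆⇒x≡y x y∈⁅x⁆)) x∈q

p∪⁅x⁆≡p : ∀ {n} {p : Subset n} {x} → x ∈ p → p ∪ ⁅ x ⁆ ≡ p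
p∪⁅x⁆≡p x∈p = ⊆-antisym (p∪⁅x⁆⊆q (λ y∈p → y∈p) x∈p) (p⊆p∪q _)

∣p∪⁅x⁆∣≡1+∣p∣ : ∀ {n} (p : Subset n) x → x ∉ p → ∣ p ∪ ⁅ x ⁆ ∣ ≡ suc ∣ p ∣
∣p∪⁅x⁆∣≡1+∣p∣ (inside ∷ p)  Fin.zero    x∉p = ⊥-elim (x∉p here)
∣p∪⁅x⁆∣≡1+∣p∣ (outside ∷ p) Fin.zero    _   = cong (λ q → suc ∣ q ∣) (∪-identityʳ p)
∣p∪⁅x⁆∣≡1+∣p∣ (inside ∷ p)  (Fin.suc x) x∉p = cong suc (∣p∪⁅x⁆∣≡1+∣p∣ p x (λ x∈p → x∉p (there x∈p)))
∣p∪⁅x⁆∣≡1+∣p∣ (outside ∷ p) (Fin.suc x) x∉p = ∣p∪⁅x⁆∣≡1+∣p∣ p x (λ x∈p → x∉p (there x∈p))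

∣p∣+∣q─p∣≡∣q∣ : ∀ {n} (p q : Subset n) → p ⊆ q → ∣ p ∣ + ∣ q ─ p ∣ ≡ ∣ q ∣
∣p∣+∣q─p∣≡∣q∣ []            []            _   = refl
∣p∣+∣q─p∣≡∣q∣ (inside ∷ p)  (inside ∷ q)  p⊆q = cong suc (∣p∣+∣q─p∣≡∣q∣ p q (drop-∷-⊆ p⊆q))
∣p∣+∣q─p∣≡∣q∣ (inside ∷ p)  (outside ∷ q) p⊆q with p⊆q here
... | ()
∣p∣+∣q─p∣≡∣q∣ (outside ∷ p) (inside ∷ q)  p⊆q = trans (+-suc ∣ p ∣ _) (cong suc (∣p∣+∣q─p∣≡∣q∣ p q (drop-∷-⊆ p⊆q)))
∣p∣+∣q─p∣≡∣q∣ (outside ∷ p) (outside ∷ q) p⊆q = ∣p∣+∣q─p∣≡∣q∣ p q (drop-∷-⊆ p⊆q)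

p∪[q─p]≡q : ∀ {n} (p q : Subset n) → p ⊆ q → p ∪ (q ─ p) ≡ q
p∪[q─p]≡q []            []            _   = refl
p∪[q─p]≡q (inside ∷ p)  (inside ∷ q)  p⊆q = cong (inside ∷_) (p∪[q─p]≡q p q (drop-∷-⊆ p⊆q))
p∪[q─p]≡q (inside ∷ p)  (outside ∷ q) p⊆q with p⊆q here
... | ()
p∪[q─p]≡q (outside ∷ p) (inside ∷ q)  p⊆q = cong (inside ∷_) (p∪[q─p]≡q p q (drop-∷-⊆ p⊆q))
p∪[q─p]≡q (outside ∷ p) (outside ∷ q) p⊆q = cong (outside ∷_) (p∪[q─p]≡q p q (drop-∷-⊆ p⊆q))

∈-tabulate⁺ : ∀ {n} (f : Fin n → Bool) {x} → f x ≡ true → x ∈ tabulate f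
∈-tabulate⁺ f {x} fx≡true = lookup⇒[]= x (tabulate f) (trans (lookup∘tabulate f x) fx≡true)

∈-tabulate⁻ : ∀ {n} (f : Fin n → Bool) {x} → x ∈ tabulate f → f x ≡ true
∈-tabulate⁻ f {x} x∈ = trans (sym (lookup∘tabulate f x)) ([]=⇒lookup x∈)

-- Rank functions: spanning, closure, independence

module MatroidProperties {n : ℕ} (M : Matroid n) where
  open Matroid M

  ρ-mono : ∀ {X Y} → X ⊆ Y → ρ X ≤ ρ Y
  ρ-mono {X} {Y} = R2 X Y

  ρ-subadditive : ∀ X Y → ρ (X ∪ Y) ≤ ρ X + ρ Y
  ρ-subadditive X Y = ≤-trans (m≤m+n (ρ (X ∪ Y)) (ρ (X ∩ Y))) (R3 X Y)

  Spans : Subset n → Fin n → Set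
  Spans S e = ρ (S ∪ ⁅ e ⁆) ≡ ρ S

  spans? : ∀ S e → Dec (Spans S e)
  spans? S e = ρ (S ∪ ⁅ e ⁆) ≟ ρ S

  ¬spans⇒< : ∀ {S e} → ¬ Spans S e → ρ S < ρ (S ∪ ⁅ e ⁆)
  ¬spans⇒< {S} {e} ¬spans = ≤∧≢⇒< (ρ-mono (p⊆p∪q ⁅ e ⁆)) (λ ρS≡ → ¬spans (sym ρS≡))

  -- submodularity applied to Z and S ∪ ⁅ e ⁆, whose intersection contains S
  spans-mono : ∀ {S Z e} → S ⊆ Z → Spans S e → Spans Z e
  spans-mono {S} {Z} {e} S⊆Z S-spans = ≤-antisym ρ[Z∪e]≤ρZ (ρ-mono (p⊆p∪q ⁅ e ⁆))
    where
    Z∪e⊆ : Z ∪ ⁅ e ⁆ ⊆ Z ∪ (S ∪ ⁅ e ⁆)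
    Z∪e⊆ x∈ with x∈p∪q⁻ Z ⁅ e ⁆ x∈
    ... | inj₁ x∈Z = x∈p∪q⁺ (inj₁ x∈Z)
    ... | inj₂ x∈e = x∈p∪q⁺ (inj₂ (x∈p∪q⁺ (inj₂ x∈e)))
    S⊆ : S ⊆ Z ∩ (S ∪ ⁅ e ⁆)
    S⊆ x∈S = x∈p∩q⁺ (S⊆Z x∈S , x∈p∪q⁺ (inj₁ x∈S))
    ρ[Z∪e]≤ρZ : ρ (Z ∪ ⁅ e ⁆) ≤ ρ Z
    ρ[Z∪e]≤ρZ = +-cancelʳ-≤ (ρ S) _ _ (begin
      ρ (Z ∪ ⁅ e ⁆) + ρ S                        ≤⟨ +-mono-≤ (ρ-mono Z∪e⊆) (ρ-mono S⊆) ⟩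
      ρ (Z ∪ (S ∪ ⁅ e ⁆)) + ρ (Z ∩ (S ∪ ⁅ e ⁆))  ≤⟨ R3 Z (S ∪ ⁅ e ⁆) ⟩
      ρ Z + ρ (S ∪ ⁅ e ⁆)                        ≡⟨ cong (ρ Z +_) S-spans ⟩
      ρ Z + ρ S                                  ∎)
      where open ≤-Reasoning

  -- add the elements of Y one at a time; each stays spanned by the larger set (spans-mono)
  spans-∪ : ∀ S Y → (∀ e → e ∈ Y → Spans S e) → ρ (S ∪ Y) ≡ ρ S
  spans-∪ S Y Y-spanned = trans (cong ρ (⊆-antisym S∪Y⊆grown (grown⊆S∪Y (allFin n)))) (ρ-grown (allFin n))
    where
    grow : List (Fin n) → Subset n
    grow []       = S
    grow (e ∷ es) = if does (e ∈? Y) then grow es ∪ ⁅ e ⁆ else grow es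

    S⊆grown : ∀ es → S ⊆ grow es
    S⊆grown []       x∈S = x∈S
    S⊆grown (e ∷ es) x∈S with does (e ∈? Y)
    ... | true  = p⊆p∪q ⁅ e ⁆ (S⊆grown es x∈S)
    ... | false = S⊆grown es x∈S

    ρ-grown : ∀ es → ρ (grow es) ≡ ρ S
    ρ-grown []       = refl
    ρ-grown (e ∷ es) with e ∈? Y
    ... | yes e∈Y = trans (spans-mono (S⊆grown es) (Y-spanned e e∈Y)) (ρ-grown es)
    ... | no  _   = ρ-grown es

    grown⊆S∪Y : ∀ es → grow es ⊆ S ∪ Y
    grown⊆S∪Y []       x∈ = p⊆p∪q Y x∈
    grown⊆S∪Y (e ∷ es) {x} x∈ with e ∈? Y
    ... | no  _   = grown⊆S∪Y es x∈
    ... | yes e∈Y with x∈p∪q⁻ (grow es) ⁅ e ⁆ x∈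
    ...   | inj₁ x∈grown = grown⊆S∪Y es x∈grown
    ...   | inj₂ x∈⁅e⁆   = x∈p∪q⁺ (inj₂ (subst (_∈ Y) (sym (x∈⁅y⁆⇒x≡y e x∈⁅e⁆)) e∈Y))

    ∈grown : ∀ es {x} → x ∈ Y → x LM.∈ es → x ∈ grow es
    ∈grown (e ∷ es) x∈Y x∈es with e ∈? Y
    ∈grown (e ∷ es) x∈Y (LA.here refl)   | yes _ = x∈p∪q⁺ (inj₂ (x∈⁅x⁆ e))
    ∈grown (e ∷ es) x∈Y (LA.there x∈es)  | yes _ = p⊆p∪q ⁅ e ⁆ (∈grown es x∈Y x∈es)
    ∈grown (e ∷ es) x∈Y (LA.here refl)   | no e∉Y = ⊥-elim (e∉Y x∈Y)
    ∈grown (e ∷ es) x∈Y (LA.there x∈es)  | no _  = ∈grown es x∈Y x∈es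

    S∪Y⊆grown : S ∪ Y ⊆ grow (allFin n)
    S∪Y⊆grown {x} x∈ with x∈p∪q⁻ S Y x∈
    ... | inj₁ x∈S = S⊆grown (allFin n) x∈S
    ... | inj₂ x∈Y = ∈grown (allFin n) x∈Y (∈-allFin x)

  rank-grows-outside-flat : ∀ {F Y e} → Flat M F → Y ⊆ F → e ∉ F → ρ Y < ρ (Y ∪ ⁅ e ⁆)
  rank-grows-outside-flat F-flat Y⊆F e∉F =
    ¬spans⇒< (λ Y-spans → <⇒≢ (F-flat _ e∉F) (sym (spans-mono Y⊆F Y-spans)))

  cl : Subset n → Subset n
  cl S = tabulate (λ e → isYes (spans? S e))

  ∈cl⇒spans : ∀ S {e} → e ∈ cl S → Spans S e
  ∈cl⇒spans S {e} e∈ = toWitness {a? = spans? S e} (Equivalence.from T-≡ (∈-tabulate⁻ (λ e → isYes (spans? S e)) e∈))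

  spans⇒∈cl : ∀ S {e} → Spans S e → e ∈ cl S
  spans⇒∈cl S {e} S-spans = ∈-tabulate⁺ (λ e → isYes (spans? S e)) (Equivalence.to T-≡ (fromWitness {a? = spans? S e} S-spans))

  ⊆cl : ∀ S → S ⊆ cl S
  ⊆cl S e∈S = spans⇒∈cl S (cong ρ (p∪⁅x⁆≡p e∈S))

  ρ-cl : ∀ S → ρ (cl S) ≡ ρ S
  ρ-cl S = begin
    ρ (cl S)     ≡⟨ cong ρ (⊆-antisym (λ x∈ → x∈p∪q⁺ (inj₂ x∈)) S∪clS⊆clS) ⟩
    ρ (S ∪ cl S) ≡⟨ spans-∪ S (cl S) (λ e → ∈cl⇒spans S) ⟩
    ρ S          ∎
    where
    open ≡-Reasoning
    S∪clS⊆clS : S ∪ cl S ⊆ cl S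
    S∪clS⊆clS x∈ with x∈p∪q⁻ S (cl S) x∈
    ... | inj₁ x∈S   = ⊆cl S x∈S
    ... | inj₂ x∈clS = x∈clS

  cl-flat : ∀ S → Flat M (cl S)
  cl-flat S e e∉clS = begin-strict
    ρ (cl S)        ≡⟨ ρ-cl S ⟩
    ρ S             <⟨ ¬spans⇒< (λ S-spans → e∉clS (spans⇒∈cl S S-spans)) ⟩
    ρ (S ∪ ⁅ e ⁆)   ≤⟨ ρ-mono S∪e⊆ ⟩
    ρ (cl S ∪ ⁅ e ⁆) ∎
    where
    open ≤-Reasoning
    S∪e⊆ : S ∪ ⁅ e ⁆ ⊆ cl S ∪ ⁅ e ⁆
    S∪e⊆ x∈ with x∈p∪q⁻ S ⁅ e ⁆ x∈
    ... | inj₁ x∈S = x∈p∪q⁺ (inj₁ (⊆cl S x∈S))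
    ... | inj₂ x∈e = x∈p∪q⁺ (inj₂ x∈e)

  cl-least : ∀ {S X} → Flat M X → S ⊆ X → cl S ⊆ X
  cl-least {S} {X} X-flat S⊆X {e} e∈clS with e ∈? X
  ... | yes e∈X = e∈X
  ... | no  e∉X = ⊥-elim (<⇒≢ (X-flat e e∉X) (sym (spans-mono S⊆X (∈cl⇒spans S e∈clS))))

  ⊆-independent : ∀ {S B} → Independent M B → S ⊆ B → Independent M S
  ⊆-independent {S} {B} B-indep S⊆B = ≤-antisym (R1 S) (+-cancelʳ-≤ ∣ B ─ S ∣ ∣ S ∣ (ρ S) (begin
    ∣ S ∣ + ∣ B ─ S ∣   ≡⟨ ∣p∣+∣q─p∣≡∣q∣ S B S⊆B ⟩
    ∣ B ∣               ≡⟨ B-indep ⟨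
    ρ B                 ≡⟨ cong ρ (p∪[q─p]≡q S B S⊆B) ⟨
    ρ (S ∪ (B ─ S))     ≤⟨ ρ-subadditive S (B ─ S) ⟩
    ρ S + ρ (B ─ S)     ≤⟨ +-monoʳ-≤ (ρ S) (R1 (B ─ S)) ⟩
    ρ S + ∣ B ─ S ∣     ∎))
    where open ≤-Reasoning

  -- an element not spanned by B would extend B to a larger independent set
  basis-spans : ∀ {B} → Basis M B → ∀ e → Spans B e
  basis-spans {B} (B-indep , B-maximal) e with e ∈? B
  ... | yes e∈B = cong ρ (p∪⁅x⁆≡p e∈B)
  ... | no  e∉B with spans? B e
  ...   | yes B-spans = B-spans
  ...   | no  ¬spans  = ⊥-elim (B-maximal e e∉B (≤-antisym (R1 _) (begin
    ∣ B ∪ ⁅ e ⁆ ∣   ≡⟨ ∣p∪⁅x⁆∣≡1+∣p∣ B e e∉B ⟩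
    suc ∣ B ∣       ≡⟨ cong suc B-indep ⟨
    suc (ρ B)       ≤⟨ ¬spans⇒< ¬spans ⟩
    ρ (B ∪ ⁅ e ⁆)   ∎)))
    where open ≤-Reasoning

  basis-rank : ∀ {B} → Basis M B → ρ B ≡ rk M
  basis-rank {B} B-basis = begin
    ρ B       ≡⟨ spans-∪ B ⊤ (λ e _ → basis-spans B-basis e) ⟨
    ρ (B ∪ ⊤) ≡⟨ cong ρ (∪-zeroʳ B) ⟩
    ρ ⊤       ∎
    where open ≡-Reasoning

  basis-size : ∀ {B} → Basis M B → ∣ B ∣ ≡ rk M
  basis-size B-basis = trans (sym (proj₁ B-basis)) (basis-rank B-basis)

-- Isomorphisms of restrictions

module Isomorphism {n : ℕ} (M : Matroid n) (π : Fin n ↔ Fin n) where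
  open Matroid M
  open MatroidProperties M
  open Inverse π using (to; from; strictlyInverseˡ; strictlyInverseʳ)

  im : Subset n → Subset n
  im = image M π

  preimage : Subset n → Subset n
  preimage Y = tabulate (λ x → lookup Y (to x))

  ∈im⁻ : ∀ Y {y} → y ∈ im Y → from y ∈ Y
  ∈im⁻ Y {y} y∈ = lookup⇒[]= (from y) Y (∈-tabulate⁻ (λ y → lookup Y (from y)) y∈)

  ∈im⁺ : ∀ Y {y} → from y ∈ Y → y ∈ im Y
  ∈im⁺ Y {y} y∈ = ∈-tabulate⁺ (λ y → lookup Y (from y)) ([]=⇒lookup y∈)

  ∈preimage⁻ : ∀ Y {x} → x ∈ preimage Y → to x ∈ Y
  ∈preimage⁻ Y {x} x∈ = lookup⇒[]= (to x) Y (∈-tabulate⁻ (λ x → lookup Y (to x)) x∈)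

  ∈preimage⁺ : ∀ Y {x} → to x ∈ Y → x ∈ preimage Y
  ∈preimage⁺ Y {x} x∈ = ∈-tabulate⁺ (λ x → lookup Y (to x)) ([]=⇒lookup x∈)

  to∈im : ∀ Y {x} → x ∈ Y → to x ∈ im Y
  to∈im Y {x} x∈Y = ∈im⁺ Y (subst (_∈ Y) (sym (strictlyInverseʳ x)) x∈Y)

  im-preimage : ∀ Y → im (preimage Y) ≡ Y
  im-preimage Y = ⊆-antisym
    (λ {y} y∈ → subst (_∈ Y) (strictlyInverseˡ y) (∈preimage⁻ Y (∈im⁻ (preimage Y) y∈)))
    (λ {y} y∈ → ∈im⁺ (preimage Y) (∈preimage⁺ Y (subst (_∈ Y) (sym (strictlyInverseˡ y)) y∈)))

  preimage-im : ∀ Y → preimage (im Y) ≡ Y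
  preimage-im Y = ⊆-antisym
    (λ {x} x∈ → subst (_∈ Y) (strictlyInverseʳ x) (∈im⁻ Y (∈preimage⁻ (im Y) x∈)))
    (λ {x} x∈ → ∈preimage⁺ (im Y) (to∈im Y x∈))

  im-∪⁅⁆ : ∀ Y x → im (Y ∪ ⁅ x ⁆) ≡ im Y ∪ ⁅ to x ⁆
  im-∪⁅⁆ Y x = ⊆-antisym ⊆-to ⊆-from
    where
    ⊆-to : im (Y ∪ ⁅ x ⁆) ⊆ im Y ∪ ⁅ to x ⁆
    ⊆-to {y} y∈ with x∈p∪q⁻ Y ⁅ x ⁆ (∈im⁻ (Y ∪ ⁅ x ⁆) y∈)
    ... | inj₁ fy∈Y  = x∈p∪q⁺ (inj₁ (∈im⁺ Y fy∈Y))
    ... | inj₂ fy∈⁅x⁆ = x∈p∪q⁺ (inj₂ (subst (_∈ ⁅ to x ⁆)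
            (trans (cong to (sym (x∈⁅y⁆⇒x≡y x fy∈⁅x⁆))) (strictlyInverseˡ y)) (x∈⁅x⁆ (to x))))
    ⊆-from : im Y ∪ ⁅ to x ⁆ ⊆ im (Y ∪ ⁅ x ⁆)
    ⊆-from {y} y∈ with x∈p∪q⁻ (im Y) ⁅ to x ⁆ y∈
    ... | inj₁ y∈imY = ∈im⁺ (Y ∪ ⁅ x ⁆) (x∈p∪q⁺ (inj₁ (∈im⁻ Y y∈imY)))
    ... | inj₂ y∈⁅tx⁆ = subst (_∈ im (Y ∪ ⁅ x ⁆)) (sym (x∈⁅y⁆⇒x≡y (to x) y∈⁅tx⁆))
                          (to∈im (Y ∪ ⁅ x ⁆) (x∈p∪q⁺ (inj₂ (x∈⁅x⁆ x))))

  module _ {X H : Subset n} (X-flat : Flat M X) (H-flat : Flat M H)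
           (π-maps : ∀ x → (x ∈ X → to x ∈ H) × (to x ∈ H → x ∈ X))
           (π-preserves-ρ : ∀ Y → Y ⊆ X → ρ (im Y) ≡ ρ Y) (k : ℕ) where

    im-subflat : ∀ Y → FlatOfRank M k Y × Y ⊆ X → FlatOfRank M k (im Y) × im Y ⊆ H
    im-subflat Y ((Y-flat , ρY≡k) , Y⊆X) = (imY-flat , trans (π-preserves-ρ Y Y⊆X) ρY≡k) , imY⊆H
      where
      imY⊆H : im Y ⊆ H
      imY⊆H {y} y∈ = subst (_∈ H) (strictlyInverseˡ y) (proj₁ (π-maps (from y)) (Y⊆X (∈im⁻ Y y∈)))
      imY-flat : Flat M (im Y)
      imY-flat e e∉ with e ∈? H
      ... | no  e∉H = rank-grows-outside-flat H-flat imY⊆H e∉H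
      ... | yes e∈H = begin-strict
        ρ (im Y)                   ≡⟨ π-preserves-ρ Y Y⊆X ⟩
        ρ Y                        <⟨ Y-flat (from e) (λ fe∈Y → e∉ (∈im⁺ Y fe∈Y)) ⟩
        ρ (Y ∪ ⁅ from e ⁆)         ≡⟨ π-preserves-ρ (Y ∪ ⁅ from e ⁆) (p∪⁅x⁆⊆q Y⊆X fe∈X) ⟨
        ρ (im (Y ∪ ⁅ from e ⁆))    ≡⟨ cong ρ (im-∪⁅⁆ Y (from e)) ⟩
        ρ (im Y ∪ ⁅ to (from e) ⁆) ≡⟨ cong (λ z → ρ (im Y ∪ ⁅ z ⁆)) (strictlyInverseˡ e) ⟩
        ρ (im Y ∪ ⁅ e ⁆)           ∎
        where
        open ≤-Reasoning
        fe∈X : from e ∈ X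
        fe∈X = proj₂ (π-maps (from e)) (subst (_∈ H) (sym (strictlyInverseˡ e)) e∈H)

    im-subflat⁻ : ∀ Y → FlatOfRank M k (im Y) × im Y ⊆ H → FlatOfRank M k Y × Y ⊆ X
    im-subflat⁻ Y ((imY-flat , ρimY≡k) , imY⊆H) = (Y-flat , trans (sym (π-preserves-ρ Y Y⊆X)) ρimY≡k) , Y⊆X
      where
      Y⊆X : Y ⊆ X
      Y⊆X {x} x∈Y = proj₂ (π-maps x) (imY⊆H (to∈im Y x∈Y))
      Y-flat : Flat M Y
      Y-flat e e∉ with e ∈? X
      ... | no  e∉X = rank-grows-outside-flat X-flat Y⊆X e∉X
      ... | yes e∈X = begin-strict
        ρ Y                      ≡⟨ π-preserves-ρ Y Y⊆X ⟨
        ρ (im Y)                 <⟨ imY-flat (to e) (λ te∈ → e∉ (subst (_∈ Y) (strictlyInverseʳ e) (∈im⁻ Y te∈))) ⟩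
        ρ (im Y ∪ ⁅ to e ⁆)      ≡⟨ cong ρ (im-∪⁅⁆ Y e) ⟨
        ρ (im (Y ∪ ⁅ e ⁆))       ≡⟨ π-preserves-ρ (Y ∪ ⁅ e ⁆) (p∪⁅x⁆⊆q Y⊆X e∈X) ⟩
        ρ (Y ∪ ⁅ e ⁆)            ∎
        where open ≤-Reasoning

    numFlatsIn-iso : numFlatsIn M X k ≡ numFlatsIn M H k
    numFlatsIn-iso = begin
      numFlatsIn M X k                 ≡⟨ count≡∑ (subflat? X) ⟩
      ∑ n (λ Y → 𝟙 (subflat? X Y))     ≡⟨ ∑-cong n (λ Y → 𝟙-⇔ (subflat? X Y) (subflat? H (im Y)) (im-subflat Y) (im-subflat⁻ Y)) ⟩
      ∑ n (λ Y → 𝟙 (subflat? H (im Y))) ≡⟨ ∑-reindex n im preimage im-preimage preimage-im (λ Y → 𝟙 (subflat? H Y)) ⟩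
      ∑ n (λ Y → 𝟙 (subflat? H Y))     ≡⟨ count≡∑ (subflat? H) ⟨
      numFlatsIn M H k                 ∎
      where
      open ≡-Reasoning
      subflat? : ∀ F Y → Dec (FlatOfRank M k Y × Y ⊆ F)
      subflat? F Y = flatOfRank? M k Y ×-dec (Y ⊆? F)

numFlatsIn-isomorphic :
  ∀ {n} (M : Matroid n) {X H} → Flat M X → Flat M H → IsoRestr M X H → ∀ k → numFlatsIn M X k ≡ numFlatsIn M H k
numFlatsIn-isomorphic M X-flat H-flat (π , π-maps , π-preserves-ρ) =
  Isomorphism.numFlatsIn-iso M π X-flat H-flat π-maps π-preserves-ρ

-- Alternating sums in ℚ

ℕ→ℚ-+ : ∀ a b → ℕ→ℚ (a + b) ≡ ℕ→ℚ a ℚ.+ ℕ→ℚ b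
ℕ→ℚ-+ a b = sym (begin
  ℕ→ℚ a ℚ.+ ℕ→ℚ b
    ≡⟨ cong₂ ℚ._+_ (normalize-coprime (coprime-1 a)) (normalize-coprime (coprime-1 b)) ⟩
  mkℚ (ℤ.+ a) 0 (coprime-1 a) ℚ.+ mkℚ (ℤ.+ b) 0 (coprime-1 b)
    ≡⟨ /-cong (cong₂ ℤ._+_ (ℤ.*-identityʳ (ℤ.+ a)) (ℤ.*-identityʳ (ℤ.+ b))) refl ⟩
  ℕ→ℚ (a + b) ∎)
  where
  open ≡-Reasoning
  coprime-1 : ∀ t → Coprime t 1
  coprime-1 t = Coprime.sym (1-coprimeTo t)

÷ℕ-exact : ∀ a d q → 1 ≤ d → d * q ≡ a → a ÷ℕ d ≡ ℕ→ℚ q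
÷ℕ-exact _ (suc b) q _ refl = fromℚᵘ-cong {mkℚᵘ (ℤ.+ (suc b * q)) b} {mkℚᵘ (ℤ.+ q) 0} (*≡* (begin
  ℤ.+ (suc b * q) ℤ.* ℤ.+ 1 ≡⟨ ℤ.*-identityʳ _ ⟩
  ℤ.+ (suc b * q)           ≡⟨ cong ℤ.+_ (*-comm (suc b) q) ⟩
  ℤ.+ (q * suc b)           ≡⟨ ℤ.pos-* q (suc b) ⟩
  ℤ.+ q ℤ.* ℤ.+ suc b       ∎))
  where open ≡-Reasoning

-- ℕ→ℚ (even k * t) − ℕ→ℚ (odd k * t) = (-1)^k t, arranged without subtraction
even-odd-sgn : ∀ k t → ℕ→ℚ (even k * t) ≡ sgn k ℚ.* ℕ→ℚ t ℚ.+ ℕ→ℚ (odd k * t)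
even-odd-sgn zero    t = begin
  ℕ→ℚ (t + 0)               ≡⟨ cong ℕ→ℚ (+-identityʳ t) ⟩
  ℕ→ℚ t                     ≡⟨ ℚS.solve 1 (λ t → t ℚS.:= ℚS.con 1ℚ ℚS.:* t ℚS.:+ ℚS.con 0ℚ) refl (ℕ→ℚ t) ⟩
  1ℚ ℚ.* ℕ→ℚ t ℚ.+ 0ℚ       ∎
  where open ≡-Reasoning
even-odd-sgn (suc k) t = sym (begin
  ℚ.- sgn k ℚ.* ℕ→ℚ t ℚ.+ ℕ→ℚ (even k * t)
    ≡⟨ cong (ℚ.- sgn k ℚ.* ℕ→ℚ t ℚ.+_) (even-odd-sgn k t) ⟩
  ℚ.- sgn k ℚ.* ℕ→ℚ t ℚ.+ (sgn k ℚ.* ℕ→ℚ t ℚ.+ ℕ→ℚ (odd k * t))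
    ≡⟨ ℚS.solve 3 (λ s t o → ℚS.:- s ℚS.:* t ℚS.:+ (s ℚS.:* t ℚS.:+ o) ℚS.:= o) refl (sgn k) (ℕ→ℚ t) (ℕ→ℚ (odd k * t)) ⟩
  ℕ→ℚ (odd k * t) ∎)
  where open ≡-Reasoning

ℕ→ℚ-∑<-even : ∀ m (T : ℕ → ℕ) →
  ℕ→ℚ (∑< m (λ k → even k * T k)) ≡ sumBelow m (λ k → sgn k ℚ.* ℕ→ℚ (T k)) ℚ.+ ℕ→ℚ (∑< m (λ k → odd k * T k))
ℕ→ℚ-∑<-even zero    T = refl
ℕ→ℚ-∑<-even (suc m) T = begin
  ℕ→ℚ (∑< m (λ k → even k * T k) + even m * T m)
    ≡⟨ ℕ→ℚ-+ (∑< m (λ k → even k * T k)) (even m * T m) ⟩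
  ℕ→ℚ (∑< m (λ k → even k * T k)) ℚ.+ ℕ→ℚ (even m * T m)
    ≡⟨ cong₂ ℚ._+_ (ℕ→ℚ-∑<-even m T) (even-odd-sgn m (T m)) ⟩
  (S ℚ.+ O) ℚ.+ (s ℚ.+ o)
    ≡⟨ ℚS.solve 4 (λ S O s o → (S ℚS.:+ O) ℚS.:+ (s ℚS.:+ o) ℚS.:= (S ℚS.:+ s) ℚS.:+ (O ℚS.:+ o)) refl S O s o ⟩
  (S ℚ.+ s) ℚ.+ (O ℚ.+ o)
    ≡⟨ cong ((S ℚ.+ s) ℚ.+_) (ℕ→ℚ-+ (∑< m (λ k → odd k * T k)) (odd m * T m)) ⟨
  sumBelow (suc m) (λ k → sgn k ℚ.* ℕ→ℚ (T k)) ℚ.+ ℕ→ℚ (∑< (suc m) (λ k → odd k * T k)) ∎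
  where
  open ≡-Reasoning
  S = sumBelow m (λ k → sgn k ℚ.* ℕ→ℚ (T k))
  O = ℕ→ℚ (∑< m (λ k → odd k * T k))
  s = sgn m ℚ.* ℕ→ℚ (T m)
  o = ℕ→ℚ (odd m * T m)

alternating-sum : ∀ m A (T : ℕ → ℕ) → A + ∑< m (λ k → odd k * T k) ≡ ∑< m (λ k → even k * T k) →
                  ℕ→ℚ A ≡ sumBelow m (λ k → sgn k ℚ.* ℕ→ℚ (T k))
alternating-sum m A T A+odd≡even = begin
  ℕ→ℚ A                   ≡⟨ ℚS.solve 2 (λ a o → a ℚS.:= (a ℚS.:+ o) ℚS.:- o) refl (ℕ→ℚ A) O ⟩
  (ℕ→ℚ A ℚ.+ O) ℚ.- O     ≡⟨ cong (ℚ._- O) (sym (ℕ→ℚ-+ A _)) ⟩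
  ℕ→ℚ (A + ∑< m (λ k → odd k * T k)) ℚ.- O ≡⟨ cong (λ x → ℕ→ℚ x ℚ.- O) A+odd≡even ⟩
  ℕ→ℚ (∑< m (λ k → even k * T k)) ℚ.- O    ≡⟨ cong (ℚ._- O) (ℕ→ℚ-∑<-even m T) ⟩
  (S ℚ.+ O) ℚ.- O         ≡⟨ ℚS.solve 2 (λ s o → (s ℚS.:+ o) ℚS.:- o ℚS.:= s) refl S O ⟩
  S                       ∎
  where
  open ≡-Reasoning
  S = sumBelow m (λ k → sgn k ℚ.* ℕ→ℚ (T k))
  O = ℕ→ℚ (∑< m (λ k → odd k * T k))

sumBelow-cong : ∀ m {f g : ℕ → ℚ} → (∀ k → k < m → f k ≡ g k) → sumBelow m f ≡ sumBelow m g
sumBelow-cong zero    _ = refl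
sumBelow-cong (suc m) e = cong₂ ℚ._+_ (sumBelow-cong m (λ k k<m → e k (m<n⇒m<1+n k<m))) (e m ≤-refl)

-- Hyperplanes through a set, and flats in an SPMD

module HyperplaneCounting {n : ℕ} (M : Matroid n) where
  open Matroid M
  open MatroidProperties M

  hyperplane? : Decidable (Hyperplane M)
  hyperplane? H = flat? M H ×-dec (suc (ρ H) ≟ rk M)

  hyperplanesAbove : Subset n → ℕ
  hyperplanesAbove = numAbove hyperplane?

  numHypAvoiding-inclusion–exclusion : ∀ B →
    numHypAvoiding M B + ∑ n (λ S → 𝟙 (S ⊆? B) * (odd ∣ S ∣ * hyperplanesAbove S))
    ≡ ∑ n (λ S → 𝟙 (S ⊆? B) * (even ∣ S ∣ * hyperplanesAbove S))
  numHypAvoiding-inclusion–exclusion B =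
    trans (cong (_+ ∑ n (λ S → 𝟙 (S ⊆? B) * (odd ∣ S ∣ * hyperplanesAbove S))) numHypAvoiding≡)
          (inclusion–exclusion-disjoint n hyperplane? B)
    where
    avoids? : ∀ H → Dec (∀ e → e ∈ B → ¬ e ∈ H)
    avoids? H = all? (λ e → (e ∈? B) →-dec ¬? (e ∈? H))
    numHypAvoiding≡ : numHypAvoiding M B ≡ ∑ n (λ H → 𝟙 (hyperplane? H) * 𝟙 (empty? (B ∩ H)))
    numHypAvoiding≡ = trans (count≡∑ (λ H → hyperplane? H ×-dec avoids? H)) (∑-cong n (λ H →
      trans (𝟙-× (hyperplane? H) (avoids? H)) (cong (𝟙 (hyperplane? H) *_) (𝟙-⇔ (avoids? H) (empty? (B ∩ H))
        (λ avoids (e , e∈B∩H) → avoids e (proj₁ (x∈p∩q⁻ B H e∈B∩H)) (proj₂ (x∈p∩q⁻ B H e∈B∩H)))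
        (λ disjoint e e∈B e∈H → disjoint (e , x∈p∩q⁺ (e∈B , e∈H)))))))

  hyperplanesAbove≡flatsAbove-cl : 1 ≤ rk M → ∀ S → hyperplanesAbove S ≡ flatsAbove M (rk M ∸ 1) (cl S)
  hyperplanesAbove≡flatsAbove-cl 1≤r S = trans (∑-cong n same) (sym (count≡∑ (λ X → corank1? X ×-dec (cl S ⊆? X))))
    where
    corank1? : ∀ X → Dec (FlatOfRank M (rk M ∸ 1) X)
    corank1? = flatOfRank? M (rk M ∸ 1)
    1+[r∸1]≡r : suc (rk M ∸ 1) ≡ rk M
    1+[r∸1]≡r = trans (+-comm 1 (rk M ∸ 1)) (m∸n+n≡m 1≤r)
    same : ∀ X → 𝟙 (hyperplane? X) * 𝟙 (S ⊆? X) ≡ 𝟙 (corank1? X ×-dec (cl S ⊆? X))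
    same X = trans (sym (𝟙-× (hyperplane? X) (S ⊆? X))) (𝟙-⇔ (hyperplane? X ×-dec (S ⊆? X)) (corank1? X ×-dec (cl S ⊆? X))
      (λ ((X-flat , 1+ρ≡r) , S⊆X) → (X-flat , cong (_∸ 1) 1+ρ≡r) , cl-least X-flat S⊆X)
      (λ ((X-flat , ρ≡r∸1) , clS⊆X) → (X-flat , trans (cong suc ρ≡r∸1) 1+[r∸1]≡r) , λ x∈S → clS⊆X (⊆cl S x∈S)))

  hyperplanesAbove-full-rank : ∀ {S} → rk M ≤ ρ S → hyperplanesAbove S ≡ 0
  hyperplanesAbove-full-rank {S} r≤ρS = ∑-zero n no-hyperplane
    where
    no-hyperplane : ∀ H → 𝟙 (hyperplane? H) * 𝟙 (S ⊆? H) ≡ 0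
    no-hyperplane H = 𝟙-incompatible (hyperplane? H) (S ⊆? H) (λ (_ , 1+ρH≡r) S⊆H → <-irrefl refl (begin-strict
      rk M           ≤⟨ r≤ρS ⟩
      ρ S            ≤⟨ ρ-mono S⊆H ⟩
      ρ H            <⟨ n<1+n (ρ H) ⟩
      suc (ρ H)      ≡⟨ 1+ρH≡r ⟩
      rk M           ∎))
      where open ≤-Reasoning

flat-incidence : ∀ {n} (M : Matroid n) u s →
  ∑ n (λ F → 𝟙 (flatOfRank? M u F) * flatsAbove M s F) ≡ ∑ n (λ X → 𝟙 (flatOfRank? M s X) * numFlatsIn M X u)
flat-incidence {n} M u s = begin
  ∑ n (λ F → 𝟙 (flatOfRank? M u F) * flatsAbove M s F)
    ≡⟨ ∑-cong n (λ F → cong (𝟙 (flatOfRank? M u F) *_) (count≡∑ (λ X → flatOfRank? M s X ×-dec (F ⊆? X)))) ⟩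
  ∑ n (λ F → 𝟙 (flatOfRank? M u F) * ∑ n (λ X → 𝟙 (flatOfRank? M s X ×-dec (F ⊆? X))))
    ≡⟨ ∑-double-count n (flatOfRank? M u) (flatOfRank? M s) _⊆?_ ⟩
  ∑ n (λ X → 𝟙 (flatOfRank? M s X) * ∑ n (λ F → 𝟙 (flatOfRank? M u F ×-dec (F ⊆? X))))
    ≡⟨ ∑-cong n (λ X → cong (𝟙 (flatOfRank? M s X) *_) (count≡∑ (λ F → flatOfRank? M u F ×-dec (F ⊆? X)))) ⟨
  ∑ n (λ X → 𝟙 (flatOfRank? M s X) * numFlatsIn M X u) ∎
  where open ≡-Reasoning

module SPMDCounting {n : ℕ} (M : Matroid n) (M-spmd : SPMD M) {H₀ : Subset n} (H₀-hyperplane : Hyperplane M H₀) where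
  open Matroid M

  r : ℕ
  r = rk M

  H₀-corank1 : FlatOfRank M (r ∸ 1) H₀
  H₀-corank1 = proj₁ H₀-hyperplane , cong (_∸ 1) (proj₂ H₀-hyperplane)

  1≤r : 1 ≤ r
  1≤r = subst (1 ≤_) (proj₂ H₀-hyperplane) (s≤s z≤n)

  r∸1<r : r ∸ 1 < r
  r∸1<r = subst (λ m → m ∸ 1 < m) (proj₂ H₀-hyperplane) ≤-refl

  numFlats-positive : ∀ {k F} → FlatOfRank M k F → 1 ≤ numFlats M k
  numFlats-positive {k} {F} F-rank-k = begin
    1                                 ≡⟨ 𝟙-yes (flatOfRank? M k F) F-rank-k ⟨
    𝟙 (flatOfRank? M k F)             ≤⟨ term≤∑ n (λ X → 𝟙 (flatOfRank? M k X)) F ⟩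
    ∑ n (λ X → 𝟙 (flatOfRank? M k X)) ≡⟨ count≡∑ (flatOfRank? M k) ⟨
    numFlats M k                      ∎
    where open ≤-Reasoning

  -- the paper's identity ⟨r|k⟩ f(r, r-1, k) = ⟨r|r-1⟩ ⟨r-1|k⟩, by counting pairs F ⊆ X
  numFlats*flatsAbove : ∀ {k F} → FlatOfRank M k F →
                        numFlats M k * flatsAbove M (r ∸ 1) F ≡ numFlats M (r ∸ 1) * numFlatsIn M H₀ k
  numFlats*flatsAbove {k} {F} F-rank-k = begin
    numFlats M k * flatsAbove M (r ∸ 1) F
      ≡⟨ cong (_* flatsAbove M (r ∸ 1) F) (count≡∑ (flatOfRank? M k)) ⟩
    ∑ n (λ G → 𝟙 (flatOfRank? M k G)) * flatsAbove M (r ∸ 1) F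
      ≡⟨ ∑-const-on n (flatOfRank? M k) (flatsAbove M (r ∸ 1)) _
           (λ G G-rank-k → SPMD.const M-spmd (r ∸ 1) k G F G-rank-k F-rank-k) ⟨
    ∑ n (λ G → 𝟙 (flatOfRank? M k G) * flatsAbove M (r ∸ 1) G)
      ≡⟨ flat-incidence M k (r ∸ 1) ⟩
    ∑ n (λ X → 𝟙 (flatOfRank? M (r ∸ 1) X) * numFlatsIn M X k)
      ≡⟨ ∑-const-on n (flatOfRank? M (r ∸ 1)) (λ X → numFlatsIn M X k) _ below-hyperplane ⟩
    ∑ n (λ X → 𝟙 (flatOfRank? M (r ∸ 1) X)) * numFlatsIn M H₀ k
      ≡⟨ cong (_* numFlatsIn M H₀ k) (count≡∑ (flatOfRank? M (r ∸ 1))) ⟨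
    numFlats M (r ∸ 1) * numFlatsIn M H₀ k ∎
    where
    open ≡-Reasoning
    below-hyperplane : ∀ X → FlatOfRank M (r ∸ 1) X → numFlatsIn M X k ≡ numFlatsIn M H₀ k
    below-hyperplane X X-corank1 = numFlatsIn-isomorphic M (proj₁ X-corank1) (proj₁ H₀-hyperplane)
      (SPMD.iso M-spmd (r ∸ 1) r∸1<r X H₀ X-corank1 H₀-corank1) k

  flatsAbove-quotient : ∀ {k F} → FlatOfRank M k F → ∀ c →
    ℕ→ℚ (c * flatsAbove M (r ∸ 1) F) ≡ (c * numFlats M (r ∸ 1) * numFlatsIn M H₀ k) ÷ℕ numFlats M k
  flatsAbove-quotient {k} {F} F-rank-k c = sym (÷ℕ-exact _ (numFlats M k) _ (numFlats-positive F-rank-k) (begin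
    numFlats M k * (c * flatsAbove M (r ∸ 1) F)   ≡⟨ solve 3 (λ a b c → a :* (c :* b) := c :* (a :* b)) refl (numFlats M k) _ c ⟩
    c * (numFlats M k * flatsAbove M (r ∸ 1) F)   ≡⟨ cong (c *_) (numFlats*flatsAbove F-rank-k) ⟩
    c * (numFlats M (r ∸ 1) * numFlatsIn M H₀ k)  ≡⟨ *-assoc c _ _ ⟨
    c * numFlats M (r ∸ 1) * numFlatsIn M H₀ k    ∎))
    where open ≡-Reasoning

module BasisCounting {n : ℕ} (M : Matroid n) (M-spmd : SPMD M) {B : Subset n} (B-basis : Basis M B)
                     {H₀ : Subset n} (H₀-hyperplane : Hyperplane M H₀) where
  open Matroid M
  open MatroidProperties M
  open HyperplaneCounting M
  open SPMDCounting M M-spmd H₀-hyperplane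

  ∣B∣≡r : ∣ B ∣ ≡ r
  ∣B∣≡r = basis-size B-basis

  cl-⊆B-flat : ∀ {S} → S ⊆ B → FlatOfRank M ∣ S ∣ (cl S)
  cl-⊆B-flat {S} S⊆B = cl-flat S , trans (ρ-cl S) (⊆-independent (proj₁ B-basis) S⊆B)

  -- a subset of B of size k, or B itself once k ≥ r
  subset-of-B : ∀ k → Σ (Subset n) λ S → S ⊆ B × ∣ S ∣ ≡ k ⊓ r
  subset-of-B k = subset-of-size B (k ⊓ r) (subst (k ⊓ r ≤_) (sym ∣B∣≡r) (m⊓n≤n k r))

  pick : ℕ → Subset n
  pick k = proj₁ (subset-of-B k)

  pick⊆B : ∀ k → pick k ⊆ B
  pick⊆B k = proj₁ (proj₂ (subset-of-B k))

  ∣pick∣ : ∀ k → ∣ pick k ∣ ≡ k ⊓ r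
  ∣pick∣ k = proj₂ (proj₂ (subset-of-B k))

  cl-pick-flat : ∀ {k} → k ≤ r → FlatOfRank M k (cl (pick k))
  cl-pick-flat {k} k≤r = subst (λ j → FlatOfRank M j (cl (pick k))) (trans (∣pick∣ k) (m≤n⇒m⊓n≡m k≤r))
                           (cl-⊆B-flat (pick⊆B k))

  hyperplanesThrough : ℕ → ℕ
  hyperplanesThrough k = hyperplanesAbove (pick k)

  hyperplanesThrough-vanishes : ∀ {k} → r ≤ k → hyperplanesThrough k ≡ 0
  hyperplanesThrough-vanishes {k} r≤k = hyperplanesAbove-full-rank (≤-reflexive (sym (begin
    ρ (pick k)   ≡⟨ ⊆-independent (proj₁ B-basis) (pick⊆B k) ⟩
    ∣ pick k ∣   ≡⟨ ∣pick∣ k ⟩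
    k ⊓ r        ≡⟨ m≥n⇒m⊓n≡n r≤k ⟩
    r            ∎)))
    where open ≡-Reasoning

  hyperplanesAbove-⊆B : ∀ {S} → S ⊆ B → hyperplanesAbove S ≡ hyperplanesThrough ∣ S ∣
  hyperplanesAbove-⊆B {S} S⊆B with ∣ S ∣ ℕ.<? r
  ... | yes ∣S∣<r = begin
    hyperplanesAbove S                     ≡⟨ hyperplanesAbove≡flatsAbove-cl 1≤r S ⟩
    flatsAbove M (r ∸ 1) (cl S)            ≡⟨ SPMD.const M-spmd (r ∸ 1) ∣ S ∣ _ _ (cl-⊆B-flat S⊆B) (cl-pick-flat (<⇒≤ ∣S∣<r)) ⟩
    flatsAbove M (r ∸ 1) (cl (pick ∣ S ∣)) ≡⟨ hyperplanesAbove≡flatsAbove-cl 1≤r (pick ∣ S ∣) ⟨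
    hyperplanesThrough ∣ S ∣               ∎
    where open ≡-Reasoning
  ... | no ∣S∣≮r = trans (hyperplanesAbove-full-rank r≤ρS) (sym (hyperplanesThrough-vanishes (≮⇒≥ ∣S∣≮r)))
    where
    r≤ρS : r ≤ ρ S
    r≤ρS = subst (r ≤_) (sym (⊆-independent (proj₁ B-basis) S⊆B)) (≮⇒≥ ∣S∣≮r)

  ∑⊆B-weighted : ∀ (w : ℕ → ℕ) →
    ∑ n (λ S → 𝟙 (S ⊆? B) * (w ∣ S ∣ * hyperplanesAbove S)) ≡ ∑< r (λ k → w k * ((r C k) * hyperplanesThrough k))
  ∑⊆B-weighted w = begin
    ∑ n (λ S → 𝟙 (S ⊆? B) * (w ∣ S ∣ * hyperplanesAbove S))
      ≡⟨ ∑⊆-by-size n B _ (λ k → w k * hyperplanesThrough k) (λ S S⊆B → cong (w ∣ S ∣ *_) (hyperplanesAbove-⊆B S⊆B)) ⟩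
    ∑< (suc n) (λ k → (∣ B ∣ C k) * (w k * hyperplanesThrough k))
      ≡⟨ cong (λ m → ∑< m f) (sym (m∸n+n≡m r≤1+n)) ⟩
    ∑< (suc n ∸ r + r) f
      ≡⟨ ∑<-truncate r (suc n ∸ r) f (λ k r≤k → trans (cong (λ h → (∣ B ∣ C k) * (w k * h)) (hyperplanesThrough-vanishes r≤k))
                                                   (trans (cong ((∣ B ∣ C k) *_) (*-zeroʳ (w k))) (*-zeroʳ (∣ B ∣ C k)))) ⟩
    ∑< r f
      ≡⟨ ∑<-cong r (λ k _ → trans (cong (λ m → (m C k) * (w k * hyperplanesThrough k)) ∣B∣≡r)
                    (solve 3 (λ c a v → c :* (a :* v) := a :* (c :* v)) refl (r C k) (w k) (hyperplanesThrough k))) ⟩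
    ∑< r (λ k → w k * ((r C k) * hyperplanesThrough k)) ∎
    where
    open ≡-Reasoning
    f : ℕ → ℕ
    f k = (∣ B ∣ C k) * (w k * hyperplanesThrough k)
    r≤1+n : r ≤ suc n
    r≤1+n = ≤-trans (≤-reflexive (sym ∣B∣≡r)) (≤-trans (∣p∣≤n B) (n≤1+n n))

  numHypAvoiding-alternating :
    numHypAvoiding M B + ∑< r (λ k → odd k * ((r C k) * hyperplanesThrough k))
    ≡ ∑< r (λ k → even k * ((r C k) * hyperplanesThrough k))
  numHypAvoiding-alternating = begin
    numHypAvoiding M B + ∑< r (λ k → odd k * ((r C k) * hyperplanesThrough k))
      ≡⟨ cong (numHypAvoiding M B +_) (∑⊆B-weighted odd) ⟨
    numHypAvoiding M B + ∑ n (λ S → 𝟙 (S ⊆? B) * (odd ∣ S ∣ * hyperplanesAbove S))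
      ≡⟨ numHypAvoiding-inclusion–exclusion B ⟩
    ∑ n (λ S → 𝟙 (S ⊆? B) * (even ∣ S ∣ * hyperplanesAbove S))
      ≡⟨ ∑⊆B-weighted even ⟩
    ∑< r (λ k → even k * ((r C k) * hyperplanesThrough k)) ∎
    where open ≡-Reasoning

  hyperplanesThrough-quotient : ∀ {k} → k < r →
    ℕ→ℚ ((r C k) * hyperplanesThrough k) ≡ ((r C k) * numFlats M (r ∸ 1) * numFlatsIn M H₀ k) ÷ℕ numFlats M k
  hyperplanesThrough-quotient {k} k<r = begin
    ℕ→ℚ ((r C k) * hyperplanesThrough k)
      ≡⟨ cong (λ h → ℕ→ℚ ((r C k) * h)) (hyperplanesAbove≡flatsAbove-cl 1≤r (pick k)) ⟩
    ℕ→ℚ ((r C k) * flatsAbove M (r ∸ 1) (cl (pick k)))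
      ≡⟨ flatsAbove-quotient (cl-pick-flat (<⇒≤ k<r)) (r C k) ⟩
    ((r C k) * numFlats M (r ∸ 1) * numFlatsIn M H₀ k) ÷ℕ numFlats M k ∎
    where open ≡-Reasoning

theorem1 : ∀ {n} (M : Matroid n) → SPMD M →
           ∀ (B : Subset n) → Basis M B →
           ∀ (H₀ : Subset n) → Hyperplane M H₀ →
           ℕ→ℚ (numHypAvoiding M B)
             ≡ sumBelow (rk M) (λ k →
                 sgn k ℚ.* (((rk M C k) ℕ.* numFlats M (rk M ∸ 1) ℕ.* numFlatsIn M H₀ k)
                            ÷ℕ numFlats M k))
theorem1 M M-spmd B B-basis H₀ H₀-hyperplane = begin
  ℕ→ℚ (numHypAvoiding M B)
    ≡⟨ alternating-sum (rk M) _ _ numHypAvoiding-alternating ⟩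
  sumBelow (rk M) (λ k → sgn k ℚ.* ℕ→ℚ ((rk M C k) * hyperplanesThrough k))
    ≡⟨ sumBelow-cong (rk M) (λ k k<r → cong (sgn k ℚ.*_) (hyperplanesThrough-quotient k<r)) ⟩
  sumBelow (rk M) (λ k → sgn k ℚ.* (((rk M C k) * numFlats M (rk M ∸ 1) * numFlatsIn M H₀ k) ÷ℕ numFlats M k)) ∎
  where
  open ≡-Reasoning
  open BasisCounting M M-spmd B-basis H₀-hyperplane
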